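{- Let $m$ be a positive integer, let $a_0,a_1,\ldots,a_m$ be real (or complex) numbers, let $P_m(x)=\sum_{k=0}^m a_kx^{m-k}$ and $P_m^*(x)=\sum_{k=0}^m a_kx^k$, and let $\varepsilon\in\{1,-1\}$. Then the following statements are equivalent: (a) $(1-x)^mP_m^*\big(\frac{x}{x-1}\big)=\varepsilon P_m^*(x)$ (as rational functions of $x$); (b) $P_m(1-x)=\varepsilon(-1)^mP_m(x)$; (c) for $n=0,1,\ldots,m$ we have $\sum_{k=0}^n\binom{n-m-1}{k}(-1)^{n-k}a_{n-k}=\varepsilon a_n$; (d) setting $a_n=0$ for $n>m$, we have $\sum_{k=0}^n\binom{n-m-1}{k}(-1)^{n-k}a_{n-k}=\varepsilon a_n$ for all $n=0,1,2,\ldots$; (e) for $n=0,1,\ldots,m$ we have $$\sum_{k=0}^n\binom nk\frac{a_k}{\binom mk}=\varepsilon(-1)^n\frac{a_n}{\binom mn}.$$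
   Context: For real $x$ and a nonnegative integer $k$, $\binom xk=x(x-1)\cdots(x-k+1)/k!$ (with $\binom x0=1$). -}

module Defs where

open import Level using (Level; _⊔_) renaming (suc to lsuc)
open import Algebra.Bundles using (CommutativeRing)
open import Data.Nat as ℕ using (ℕ; zero; suc; _∸_; _≤_; _≤?_)
open import Data.Integer as ℤ using (ℤ; +_; -[1+_])
open import Data.Nat.Combinatorics using (_C_)
open import Relation.Binary.PropositionalEquality using (_≡_)
open import Relation.Nullary using (¬_; yes; no)

module RingNat {c ℓ : Level} (R : CommutativeRing c ℓ) where
  open CommutativeRing R
  fromℕ : ℕ → Carrier
  fromℕ zero = 0#
  fromℕ (suc n) = 1# + fromℕ n

-- A field of characteristic zero (covers ℝ and ℂ).  The inverse is a
-- total function (the value at 0 is unconstrained and never used).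
record Field (c ℓ : Level) : Set (lsuc (c ⊔ ℓ)) where
  field
    commutativeRing : CommutativeRing c ℓ
  open CommutativeRing commutativeRing public
  open RingNat commutativeRing public
  field
    _⁻¹        : Carrier → Carrier
    ⁻¹-inverse : ∀ x → ¬ (x ≈ 0#) → x * (x ⁻¹) ≈ 1#
    char0      : ∀ n → fromℕ n ≈ 0# → n ≡ 0

module Defns {c ℓ : Level} (F : Field c ℓ) where
  open Field F public

  fromℤ : ℤ → Carrier
  fromℤ (+ n) = fromℕ n
  fromℤ -[1+ n ] = - fromℕ (suc n)

  pow : Carrier → ℕ → Carrier
  pow x zero = 1#
  pow x (suc k) = x * pow x k

  sign : ℕ → Carrier
  sign k = pow (- 1#) k

  sumTo : ℕ → (ℕ → Carrier) → Carrier
  sumTo zero f = f 0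
  sumTo (suc n) f = sumTo n f + f (suc n)

  falling : Carrier → ℕ → Carrier
  falling x zero = 1#
  falling x (suc k) = falling x k * (x - fromℕ k)

  binom : Carrier → ℕ → Carrier
  binom x k = falling x k * (fromℕ (k ℕ.!) ⁻¹)

  P : ℕ → (ℕ → Carrier) → Carrier → Carrier
  P m a x = sumTo m (λ k → a k * pow x (m ∸ k))

  P* : ℕ → (ℕ → Carrier) → Carrier → Carrier
  P* m a x = sumTo m (λ k → a k * pow x k)

  extend : ℕ → (ℕ → Carrier) → ℕ → Carrier
  extend m a n with n ≤? m
  ... | yes _ = a n
  ... | no _ = 0#

  sumC : ℕ → (ℕ → Carrier) → ℕ → Carrier
  sumC m a n = sumTo n (λ k →
    binom (fromℤ ((+ n) ℤ.- (+ suc m))) k * (sign (n ∸ k) * a (n ∸ k)))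

  -- (a): identity of rational functions, i.e. for all x ≠ 1
  CondA : ℕ → (ℕ → Carrier) → Carrier → Set (c ⊔ ℓ)
  CondA m a ε = ∀ x → ¬ (x ≈ 1#) →
    pow (1# - x) m * P* m a (x * ((x - 1#) ⁻¹)) ≈ ε * P* m a x

  CondB : ℕ → (ℕ → Carrier) → Carrier → Set (c ⊔ ℓ)
  CondB m a ε = ∀ x → P m a (1# - x) ≈ ε * (sign m * P m a x)

  CondC : ℕ → (ℕ → Carrier) → Carrier → Set ℓ
  CondC m a ε = ∀ n → n ≤ m → sumC m a n ≈ ε * a n

  CondD : ℕ → (ℕ → Carrier) → Carrier → Set ℓ
  CondD m a ε = ∀ n → sumC m (extend m a) n ≈ ε * extend m a n

  CondE : ℕ → (ℕ → Carrier) → Carrier → Set ℓ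
  CondE m a ε = ∀ n → n ≤ m →
    sumTo n (λ k → fromℕ (n C k) * (a k * (fromℕ (m C k) ⁻¹)))
      ≈ ε * (sign n * (a n * (fromℕ (m C n) ⁻¹)))

module Submission where

-- Idea: let  b_n = Σ_{k≤n} C(m-k, n-k) a_k  be the coefficients of the form
-- Σ_k a_k u^k v^(m-k)  after the shear  v ↦ u + v  (module Shear, from the
-- binomial theorem).  Each condition is equivalent to
--      (S)   (-1)^n b_n = ε a_n   for all n ≤ m   (module Conditions):
-- (a) and (b) are the shear at (u, v) = (-x, 1) and (1, -x), read off
-- coefficientwise by the identity theorem for polynomials (module
-- PolynomialIdentity); (c) uses  binom(n-m-1, k) = (-1)^k C(m-n+k, k)  (module
-- IntegerBinomials); (d) adds only sums that vanish term by term; (e) uses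
-- C(m-k, n-k) C(m, k) = C(m, n) C(n, k).

open import Defs
open import Level using (Level; 0ℓ)
open import Data.Nat as ℕ using (ℕ; zero; suc; _≤_; _<_; _∸_; z≤n; s≤s; _!)
import Data.Nat.Properties as ℕP
open import Data.Nat.Combinatorics using (_C_; nCk≡n!/k![n-k]!; k![n∸k]!∣n!)
open import Data.Nat.DivMod using (m/n*n≡m)
open import Data.Nat.Solver using (module +-*-Solver)
open import Data.Integer as ℤ using (+_; -[1+_])
import Data.Integer.Properties as ℤP
open import Data.Fin using (toℕ)
open import Data.Maybe using (Maybe; just; nothing)
open import Data.Sum using (_⊎_)
open import Data.Product using (_×_; _,_)
open import Function.Bundles using (_⇔_; mk⇔; module Equivalence)
open import Function.Construct.Composition using (_⇔-∘_)
open import Function.Construct.Symmetry using (⇔-sym)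
open import Relation.Nullary using (¬_; Dec; yes; no)
open import Relation.Binary.PropositionalEquality as ≡ using (_≡_)
open import Algebra.Bundles using (CommutativeRing; RawRing)
open import Data.Empty using (⊥-elim)
import Algebra.Solver.Ring.AlmostCommutativeRing as ACR

module Arithmetic {c ℓ : Level} (F : Field c ℓ) where
  open Defns F
  open import Relation.Binary.Reasoning.Setoid setoid
  open import Algebra.Properties.Group +-group public
    using (ε⁻¹≈ε; ⁻¹-involutive; x∙y⁻¹≈ε⇒x≈y)
  open import Algebra.Properties.AbelianGroup +-abelianGroup public
    using (⁻¹-∙-comm; xyx⁻¹≈y)
  open import Algebra.Properties.Ring ring public
    using (-‿distribˡ-*; -‿distribʳ-*; -1*x≈-x)
  open import Algebra.Properties.Semiring.Mult semiring public
    using (×-homo-+; ×1-homo-*; ×-assoc-*; ×-congʳ) renaming (_×_ to _·_)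

  fromℕ≡·1 : ∀ n → fromℕ n ≡ n · 1#
  fromℕ≡·1 zero = ≡.refl
  fromℕ≡·1 (suc n) = ≡.cong (_+_ 1#) (fromℕ≡·1 n)

  fromℕ-+ : ∀ m n → fromℕ (m ℕ.+ n) ≈ fromℕ m + fromℕ n
  fromℕ-+ m n rewrite fromℕ≡·1 (m ℕ.+ n) | fromℕ≡·1 m | fromℕ≡·1 n = ×-homo-+ 1# m n

  fromℕ-* : ∀ m n → fromℕ (m ℕ.* n) ≈ fromℕ m * fromℕ n
  fromℕ-* m n rewrite fromℕ≡·1 (m ℕ.* n) | fromℕ≡·1 m | fromℕ≡·1 n = ×1-homo-* m n

  ·≈fromℕ* : ∀ n x → n · x ≈ fromℕ n * x
  ·≈fromℕ* n x rewrite fromℕ≡·1 n =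
    trans (×-congʳ n (sym (*-identityˡ x))) (sym (×-assoc-* n 1# x))

  1+-sub-1+ : ∀ a b → (1# + a) - (1# + b) ≈ a - b
  1+-sub-1+ a b = begin
    (1# + a) + - (1# + b)     ≈⟨ +-congˡ (sym (⁻¹-∙-comm 1# b)) ⟩
    (1# + a) + (- 1# + - b)   ≈⟨ sym (+-assoc _ _ _) ⟩
    ((1# + a) + - 1#) + - b   ≈⟨ +-congʳ (xyx⁻¹≈y 1# a) ⟩
    a + - b                   ∎

  fromℤ-⊖ : ∀ m n → fromℤ (m ℤ.⊖ n) ≈ fromℕ m - fromℕ n
  fromℤ-⊖ m zero = sym (trans (+-congˡ ε⁻¹≈ε) (+-identityʳ _))
  fromℤ-⊖ zero (suc n) = sym (+-identityˡ _)
  fromℤ-⊖ (suc m) (suc n) = begin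
    fromℤ (suc m ℤ.⊖ suc n)   ≡⟨ ≡.cong fromℤ (ℤP.[1+m]⊖[1+n]≡m⊖n m n) ⟩
    fromℤ (m ℤ.⊖ n)           ≈⟨ fromℤ-⊖ m n ⟩
    fromℕ m - fromℕ n         ≈⟨ sym (1+-sub-1+ _ _) ⟩
    fromℕ (suc m) - fromℕ (suc n) ∎

  fromℤ-neg : ∀ i → fromℤ (ℤ.- i) ≈ - fromℤ i
  fromℤ-neg -[1+ n ] = sym (⁻¹-involutive _)
  fromℤ-neg (+ zero) = sym ε⁻¹≈ε
  fromℤ-neg (+ suc n) = refl

  fromℤ-+ : ∀ i j → fromℤ (i ℤ.+ j) ≈ fromℤ i + fromℤ j
  fromℤ-+ (+ m) (+ n) = fromℕ-+ m n
  fromℤ-+ (+ m) -[1+ n ] = fromℤ-⊖ m (suc n)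
  fromℤ-+ -[1+ m ] (+ n) = trans (fromℤ-⊖ n (suc m)) (+-comm _ _)
  fromℤ-+ -[1+ m ] -[1+ n ] = begin
    - fromℕ (suc (suc (m ℕ.+ n)))      ≡⟨ ≡.cong (λ k → - fromℕ k) (≡.sym (ℕP.+-suc (suc m) n)) ⟩
    - fromℕ (suc m ℕ.+ suc n)          ≈⟨ -‿cong (fromℕ-+ (suc m) (suc n)) ⟩
    - (fromℕ (suc m) + fromℕ (suc n))  ≈⟨ sym (⁻¹-∙-comm _ _) ⟩
    - fromℕ (suc m) + - fromℕ (suc n)  ∎

  fromℤ-+* : ∀ m j → fromℤ (+ m ℤ.* j) ≈ fromℕ m * fromℤ j
  fromℤ-+* m (+ n) = trans (reflexive (≡.cong fromℤ (≡.sym (ℤP.pos-* m n)))) (fromℕ-* m n)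
  fromℤ-+* m -[1+ n ] = begin
    fromℤ (+ m ℤ.* -[1+ n ])          ≡⟨ ≡.cong fromℤ (≡.sym (ℤP.neg-distribʳ-* (+ m) (+ suc n))) ⟩
    fromℤ (ℤ.- (+ m ℤ.* + suc n))     ≈⟨ fromℤ-neg (+ m ℤ.* + suc n) ⟩
    - fromℤ (+ m ℤ.* + suc n)         ≈⟨ -‿cong (fromℤ-+* m (+ suc n)) ⟩
    - (fromℕ m * fromℕ (suc n))       ≈⟨ -‿distribʳ-* _ _ ⟩
    fromℕ m * - fromℕ (suc n)         ∎

  fromℤ-* : ∀ i j → fromℤ (i ℤ.* j) ≈ fromℤ i * fromℤ j
  fromℤ-* (+ m) j = fromℤ-+* m j
  fromℤ-* -[1+ m ] j = begin
    fromℤ (-[1+ m ] ℤ.* j)            ≡⟨ ≡.cong fromℤ (≡.sym (ℤP.neg-distribˡ-* (+ suc m) j)) ⟩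
    fromℤ (ℤ.- (+ suc m ℤ.* j))       ≈⟨ fromℤ-neg (+ suc m ℤ.* j) ⟩
    - fromℤ (+ suc m ℤ.* j)           ≈⟨ -‿cong (fromℤ-+* (suc m) j) ⟩
    - (fromℕ (suc m) * fromℤ j)       ≈⟨ -‿distribˡ-* _ _ ⟩
    - fromℕ (suc m) * fromℤ j         ∎

  -- The ring solver for F, with integer coefficients interpreted by fromℤ.
  private
    ℤ-rawRing : RawRing 0ℓ 0ℓ
    ℤ-rawRing = CommutativeRing.rawRing ℤP.+-*-commutativeRing

    F-ring : ACR.AlmostCommutativeRing c ℓ
    F-ring = ACR.fromCommutativeRing commutativeRing

    fromℤ-morphism : ℤ-rawRing ACR.-Raw-AlmostCommutative⟶ F-ring
    fromℤ-morphism = record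
      { ⟦_⟧    = fromℤ
      ; +-homo = fromℤ-+
      ; *-homo = fromℤ-*
      ; -‿homo = fromℤ-neg
      ; 0-homo = refl
      ; 1-homo = +-identityʳ 1#
      }

    fromℤ-≟ : ∀ i j → Maybe (fromℤ i ≈ fromℤ j)
    fromℤ-≟ i j with i ℤ.≟ j
    ... | yes ≡.refl = just refl
    ... | no _ = nothing

  open import Algebra.Solver.Ring ℤ-rawRing F-ring fromℤ-morphism fromℤ-≟ public
    using (solve; _:+_; _:*_; _:-_; :-_; _:=_)

  ⁻¹-cancelˡ : ∀ {z} x → ¬ (z ≈ 0#) → z ⁻¹ * (z * x) ≈ x
  ⁻¹-cancelˡ {z} x z≉0 = begin
    z ⁻¹ * (z * x)     ≈⟨ sym (*-assoc _ _ _) ⟩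
    (z ⁻¹ * z) * x     ≈⟨ *-congʳ (trans (*-comm _ _) (⁻¹-inverse z z≉0)) ⟩
    1# * x             ≈⟨ *-identityˡ x ⟩
    x                  ∎

  no-zero-divisors : ∀ {z e} → ¬ (z ≈ 0#) → z * e ≈ 0# → e ≈ 0#
  no-zero-divisors {z} {e} z≉0 ze≈0 =
    trans (sym (⁻¹-cancelˡ e z≉0)) (trans (*-congˡ ze≈0) (zeroʳ _))

  *-cancelʳ : ∀ {x y z} → ¬ (z ≈ 0#) → x * z ≈ y * z → x ≈ y
  *-cancelʳ {x} {y} {z} z≉0 xz≈yz = x∙y⁻¹≈ε⇒x≈y x y (no-zero-divisors z≉0 (begin
    z * (x - y)        ≈⟨ solve 3 (λ x y z → z :* (x :- y) := (x :* z) :- (y :* z)) refl x y z ⟩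
    x * z - y * z      ≈⟨ +-congʳ xz≈yz ⟩
    y * z - y * z      ≈⟨ -‿inverseʳ _ ⟩
    0#                 ∎))

  fromℕ≉0 : ∀ {n} → ¬ (n ≡ 0) → ¬ (fromℕ n ≈ 0#)
  fromℕ≉0 n≢0 e = n≢0 (char0 _ e)

  fromℕ-injective : ∀ {s t} → fromℕ s ≈ fromℕ t → s ≡ t
  fromℕ-injective {zero} {zero} _ = ≡.refl
  fromℕ-injective {zero} {suc t} e = ⊥-elim (fromℕ≉0 {suc t} (λ ()) (sym e))
  fromℕ-injective {suc s} {zero} e = ⊥-elim (fromℕ≉0 {suc s} (λ ()) e)
  fromℕ-injective {suc s} {suc t} e = ≡.cong suc (fromℕ-injective (begin
    fromℕ s                      ≈⟨ solve 2 (λ o y → y := (o :+ y) :- o) refl 1# _ ⟩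
    (1# + fromℕ s) - 1#          ≈⟨ +-congʳ e ⟩
    (1# + fromℕ t) - 1#          ≈⟨ solve 2 (λ o y → (o :+ y) :- o := y) refl 1# _ ⟩
    fromℕ t                      ∎))

module Powers {c ℓ : Level} (F : Field c ℓ) where
  open Defns F
  open Arithmetic F
  open import Relation.Binary.Reasoning.Setoid setoid
  open import Algebra.Properties.CommutativeSemiring.Exp commutativeSemiring
    using (_^_; ^-congˡ; ^-homo-*; ^-distrib-*)

  pow≡^ : ∀ x n → pow x n ≡ x ^ n
  pow≡^ x zero = ≡.refl
  pow≡^ x (suc n) = ≡.cong (_*_ x) (pow≡^ x n)

  pow-cong : ∀ {x y} n → x ≈ y → pow x n ≈ pow y n
  pow-cong {x} {y} n x≈y rewrite pow≡^ x n | pow≡^ y n = ^-congˡ n x≈y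

  pow-+ : ∀ x m n → pow x (m ℕ.+ n) ≈ pow x m * pow x n
  pow-+ x m n rewrite pow≡^ x (m ℕ.+ n) | pow≡^ x m | pow≡^ x n = ^-homo-* x m n

  pow-* : ∀ x y n → pow (x * y) n ≈ pow x n * pow y n
  pow-* x y n rewrite pow≡^ (x * y) n | pow≡^ x n | pow≡^ y n = ^-distrib-* x y n

  pow-1 : ∀ n → pow 1# n ≈ 1#
  pow-1 zero = refl
  pow-1 (suc n) = trans (*-identityˡ _) (pow-1 n)

  pow-neg : ∀ x n → pow (- x) n ≈ sign n * pow x n
  pow-neg x n = trans (pow-cong n (sym (-1*x≈-x x))) (pow-* (- 1#) x n)

  sign-sq : ∀ n → sign n * sign n ≈ 1#
  sign-sq n = begin
    sign n * sign n         ≈⟨ sym (pow-* (- 1#) (- 1#) n) ⟩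
    pow (- 1# * - 1#) n     ≈⟨ pow-cong n (trans (-1*x≈-x (- 1#)) (⁻¹-involutive 1#)) ⟩
    pow 1# n                ≈⟨ pow-1 n ⟩
    1#                      ∎

  sign-cancel : ∀ n x → sign n * (sign n * x) ≈ x
  sign-cancel n x = trans (sym (*-assoc _ _ _)) (trans (*-congʳ (sign-sq n)) (*-identityˡ x))

  sign-split : ∀ {k n} → k ≤ n → sign k * sign (n ∸ k) ≈ sign n
  sign-split {k} {n} k≤n = trans (sym (pow-+ (- 1#) k (n ∸ k)))
    (reflexive (≡.cong sign (ℕP.m+[n∸m]≡n k≤n)))

  sign-∸ : ∀ {k n} → k ≤ n → sign (n ∸ k) ≈ sign n * sign k
  sign-∸ {k} {n} k≤n = begin
    sign (n ∸ k)                       ≈⟨ sym (sign-cancel k _) ⟩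
    sign k * (sign k * sign (n ∸ k))   ≈⟨ *-congˡ (sign-split k≤n) ⟩
    sign k * sign n                    ≈⟨ *-comm _ _ ⟩
    sign n * sign k                    ∎

module Sums {c ℓ : Level} (F : Field c ℓ) where
  open Defns F
  open Arithmetic F
  open import Relation.Binary.Reasoning.Setoid setoid
  open import Algebra.Properties.Monoid.Sum +-monoid using (sum⁺-syntax)

  sumTo-cong : ∀ n {f g} → (∀ k → k ≤ n → f k ≈ g k) → sumTo n f ≈ sumTo n g
  sumTo-cong zero f≈g = f≈g 0 z≤n
  sumTo-cong (suc n) f≈g =
    +-cong (sumTo-cong n (λ k k≤n → f≈g k (ℕP.m≤n⇒m≤1+n k≤n))) (f≈g (suc n) ℕP.≤-refl)

  sumTo-0 : ∀ n f → (∀ k → k ≤ n → f k ≈ 0#) → sumTo n f ≈ 0#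
  sumTo-0 zero f f≈0 = f≈0 0 z≤n
  sumTo-0 (suc n) f f≈0 = trans
    (+-cong (sumTo-0 n f (λ k k≤n → f≈0 k (ℕP.m≤n⇒m≤1+n k≤n))) (f≈0 (suc n) ℕP.≤-refl))
    (+-identityʳ _)

  sumTo-+ : ∀ n f g → sumTo n (λ k → f k + g k) ≈ sumTo n f + sumTo n g
  sumTo-+ zero f g = refl
  sumTo-+ (suc n) f g = trans (+-congʳ (sumTo-+ n f g))
    (solve 4 (λ a b x y → (a :+ b) :+ (x :+ y) := (a :+ x) :+ (b :+ y)) refl _ _ _ _)

  sumTo-- : ∀ n f g → sumTo n (λ k → f k - g k) ≈ sumTo n f - sumTo n g
  sumTo-- zero f g = refl
  sumTo-- (suc n) f g = trans (+-congʳ (sumTo-- n f g))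
    (solve 4 (λ a b x y → (a :- b) :+ (x :- y) := (a :+ x) :- (b :+ y)) refl _ _ _ _)

  sumTo-*ˡ : ∀ n x f → x * sumTo n f ≈ sumTo n (λ k → x * f k)
  sumTo-*ˡ zero x f = refl
  sumTo-*ˡ (suc n) x f = trans (distribˡ _ _ _) (+-congʳ (sumTo-*ˡ n x f))

  sumTo-*ʳ : ∀ n f y → sumTo n f * y ≈ sumTo n (λ k → f k * y)
  sumTo-*ʳ n f y =
    trans (*-comm _ _) (trans (sumTo-*ˡ n y f) (sumTo-cong n (λ k _ → *-comm _ _)))

  sumTo-shift : ∀ n f → sumTo (suc n) f ≈ f 0 + sumTo n (λ k → f (suc k))
  sumTo-shift zero f = refl
  sumTo-shift (suc n) f = trans (+-congʳ (sumTo-shift n f)) (+-assoc _ _ _)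

  sumTo-rev : ∀ n f → sumTo n f ≈ sumTo n (λ k → f (n ∸ k))
  sumTo-rev zero f = refl
  sumTo-rev (suc n) f = begin
    sumTo n f + f (suc n)                    ≈⟨ +-congʳ (sumTo-rev n f) ⟩
    sumTo n (λ k → f (n ∸ k)) + f (suc n)    ≈⟨ +-comm _ _ ⟩
    f (suc n) + sumTo n (λ k → f (n ∸ k))    ≈⟨ sym (sumTo-shift n (λ k → f (suc n ∸ k))) ⟩
    sumTo (suc n) (λ k → f (suc n ∸ k))      ∎

  sumTo≈∑ : ∀ n f → sumTo n f ≈ ∑[ i ≤ n ] f (toℕ i)
  sumTo≈∑ zero f = sym (+-identityʳ _)
  sumTo≈∑ (suc n) f = trans (sumTo-shift n f) (+-congˡ (sumTo≈∑ n (λ k → f (suc k))))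

  sumTo-triangle : ∀ M (f : ℕ → ℕ → Carrier) →
    sumTo M (λ n → sumTo n (λ k → f n k))
      ≈ sumTo M (λ k → sumTo (M ∸ k) (λ i → f (k ℕ.+ i) k))
  sumTo-triangle zero f = refl
  sumTo-triangle (suc M) f = begin
    sumTo M (λ n → sumTo n (f n)) + sumTo (suc M) (f (suc M))
      ≈⟨ +-congʳ (sumTo-triangle M f) ⟩
    sumTo M row + (sumTo M (f (suc M)) + f (suc M) (suc M))
      ≈⟨ sym (+-assoc _ _ _) ⟩
    (sumTo M row + sumTo M (f (suc M))) + f (suc M) (suc M)
      ≈⟨ +-cong (sym (sumTo-+ M row (f (suc M)))) last-row ⟩
    sumTo M (λ k → row k + f (suc M) k) + row′ (suc M)
      ≈⟨ +-congʳ (sumTo-cong M extend-row) ⟩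
    sumTo M row′ + row′ (suc M)
      ∎
    where
    row row′ : ℕ → Carrier
    row k = sumTo (M ∸ k) (λ i → f (k ℕ.+ i) k)
    row′ k = sumTo (suc M ∸ k) (λ i → f (k ℕ.+ i) k)
    last-row : f (suc M) (suc M) ≈ row′ (suc M)
    last-row = begin
      f (suc M) (suc M)          ≡⟨ ≡.cong (λ j → f j (suc M)) (≡.sym (ℕP.+-identityʳ (suc M))) ⟩
      f (suc M ℕ.+ 0) (suc M)    ≡⟨ ≡.cong (λ l → sumTo l (λ i → f (suc M ℕ.+ i) (suc M)))
                                      (≡.sym (ℕP.n∸n≡0 (suc M))) ⟩
      row′ (suc M)               ∎
    extend-row : ∀ k → k ≤ M → row k + f (suc M) k ≈ row′ k
    extend-row k k≤M = begin
      row k + f (suc M) k                   ≡⟨ ≡.cong (λ j → row k + f j k) M+1≡k+[M-k+1] ⟩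
      row k + f (k ℕ.+ suc (M ∸ k)) k       ≡⟨ ≡.cong (λ l → sumTo l (λ i → f (k ℕ.+ i) k))
                                                  (≡.sym (ℕP.+-∸-assoc 1 k≤M)) ⟩
      row′ k                                ∎
      where
      M+1≡k+[M-k+1] : suc M ≡ k ℕ.+ suc (M ∸ k)
      M+1≡k+[M-k+1] = ≡.trans (≡.cong suc (≡.sym (ℕP.m+[n∸m]≡n k≤M))) (≡.sym (ℕP.+-suc k (M ∸ k)))

module Shear {c ℓ : Level} (F : Field c ℓ) where
  open Defns F
  open Arithmetic F
  open Powers F
  open Sums F
  open import Relation.Binary.Reasoning.Setoid setoid
  open import Algebra.Properties.CommutativeSemiring.Exp commutativeSemiring using (_^_)
  import Algebra.Properties.CommutativeSemiring.Binomial commutativeSemiring as Library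

  binomial : ∀ N u v →
    pow (u + v) N ≈ sumTo N (λ i → fromℕ (N C i) * (pow u i * pow v (N ∸ i)))
  binomial N u v = begin
    pow (u + v) N                                    ≡⟨ pow≡^ (u + v) N ⟩
    (u + v) ^ N                                      ≈⟨ Library.theorem N u v ⟩
    Library.binomialExpansion u v N                  ≈⟨ sym (sumTo≈∑ N term) ⟩
    sumTo N term                                     ≈⟨ sumTo-cong N (λ i _ → term≈ i) ⟩
    sumTo N (λ i → fromℕ (N C i) * (pow u i * pow v (N ∸ i))) ∎
    where
    term : ℕ → Carrier
    term i = (N C i) · (u ^ i * v ^ (N ∸ i))
    term≈ : ∀ i → term i ≈ fromℕ (N C i) * (pow u i * pow v (N ∸ i))
    term≈ i = trans (·≈fromℕ* (N C i) _)
      (*-congˡ (reflexive (≡.sym (≡.cong₂ _*_ (pow≡^ u i) (pow≡^ v (N ∸ i))))))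

  -- sheared m a n = Σ_{k ≤ n} C(m - k, n - k) a_k  is the coefficient of
  -- u^n v^(m-n) after substituting  v ↦ u + v  in  Σ_k a_k u^k v^(m-k).
  sheared : ℕ → (ℕ → Carrier) → ℕ → Carrier
  sheared m a n = sumTo n (λ k → fromℕ ((m ∸ k) C (n ∸ k)) * a k)

  shear-expansion : ∀ m a u v →
    sumTo m (λ k → a k * (pow u k * pow (u + v) (m ∸ k)))
      ≈ sumTo m (λ n → sheared m a n * (pow u n * pow v (m ∸ n)))
  shear-expansion m a u v = begin
    sumTo m (λ k → a k * (pow u k * pow (u + v) (m ∸ k)))
      ≈⟨ sumTo-cong m (λ k _ → expand k) ⟩
    sumTo m (λ k → sumTo (m ∸ k) (λ i → f (k ℕ.+ i) k))
      ≈⟨ sym (sumTo-triangle m f) ⟩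
    sumTo m (λ n → sumTo n (λ k → f n k))
      ≈⟨ sumTo-cong m (λ n _ → sym (sumTo-*ʳ n _ (monomial n))) ⟩
    sumTo m (λ n → sheared m a n * monomial n)
      ∎
    where
    monomial : ℕ → Carrier
    monomial n = pow u n * pow v (m ∸ n)
    -- the contribution of a_k to the coefficient of monomial n
    f : ℕ → ℕ → Carrier
    f n k = (fromℕ ((m ∸ k) C (n ∸ k)) * a k) * monomial n
    term : ∀ k i →
      a k * (pow u k * (fromℕ ((m ∸ k) C i) * (pow u i * pow v (m ∸ k ∸ i)))) ≈ f (k ℕ.+ i) k
    term k i = begin
      a k * (pow u k * (fromℕ ((m ∸ k) C i) * (pow u i * pow v (m ∸ k ∸ i))))
        ≈⟨ solve 5 (λ a p c q r → a :* (p :* (c :* (q :* r))) := (c :* a) :* ((p :* q) :* r))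
             refl _ _ _ _ _ ⟩
      (fromℕ ((m ∸ k) C i) * a k) * ((pow u k * pow u i) * pow v (m ∸ k ∸ i))
        ≈⟨ *-cong (*-congʳ (reflexive (≡.cong (λ j → fromℕ ((m ∸ k) C j)) (≡.sym (ℕP.m+n∸m≡n k i)))))
                  (*-cong (sym (pow-+ u k i)) (reflexive (≡.cong (pow v) (ℕP.∸-+-assoc m k i)))) ⟩
      f (k ℕ.+ i) k
        ∎
    expand : ∀ k → a k * (pow u k * pow (u + v) (m ∸ k)) ≈ sumTo (m ∸ k) (λ i → f (k ℕ.+ i) k)
    expand k = begin
      a k * (pow u k * pow (u + v) (m ∸ k))   ≈⟨ *-congˡ (*-congˡ (binomial (m ∸ k) u v)) ⟩
      a k * (pow u k * sumTo (m ∸ k) _)       ≈⟨ *-congˡ (sumTo-*ˡ (m ∸ k) _ _) ⟩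
      a k * sumTo (m ∸ k) _                   ≈⟨ sumTo-*ˡ (m ∸ k) _ _ ⟩
      sumTo (m ∸ k) _                         ≈⟨ sumTo-cong (m ∸ k) (λ i _ → term k i) ⟩
      sumTo (m ∸ k) (λ i → f (k ℕ.+ i) k)     ∎

module PolynomialIdentity {c ℓ : Level} (F : Field c ℓ) where
  open Defns F
  open Arithmetic F
  open Sums F
  open import Relation.Binary.Reasoning.Setoid setoid

  tail : (ℕ → Carrier) → ℕ → Carrier
  tail c i = c (suc i)

  P*-suc : ∀ d c x → P* (suc d) c x ≈ c 0 + x * P* d (tail c) x
  P*-suc d c x = begin
    P* (suc d) c x
      ≈⟨ sumTo-shift d (λ i → c i * pow x i) ⟩
    c 0 * 1# + sumTo d (λ i → c (suc i) * (x * pow x i))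
      ≈⟨ +-cong (*-identityʳ _) (sumTo-cong d (λ i _ →
           solve 3 (λ a x p → a :* (x :* p) := x :* (a :* p)) refl _ _ _)) ⟩
    c 0 + sumTo d (λ i → x * (c (suc i) * pow x i))
      ≈⟨ +-congˡ (sym (sumTo-*ˡ d x _)) ⟩
    c 0 + x * P* d (tail c) x
      ∎

  P*-cong : ∀ d {p q} → (∀ i → i ≤ d → p i ≈ q i) → ∀ x → P* d p x ≈ P* d q x
  P*-cong d p≈q x = sumTo-cong d (λ i i≤d → *-congʳ (p≈q i i≤d))

  P*-scale : ∀ d e p x → e * P* d p x ≈ P* d (λ i → e * p i) x
  P*-scale d e p x = trans (sumTo-*ˡ d e _) (sumTo-cong d (λ _ _ → sym (*-assoc _ _ _)))

  P*-zero : ∀ d c x → (∀ i → i ≤ d → c i ≈ 0#) → P* d c x ≈ 0#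
  P*-zero d c x c≈0 = sumTo-0 d _ (λ i i≤d → trans (*-congʳ (c≈0 i i≤d)) (zeroˡ _))

  -- Synthetic division by  x - r:  P*(x) = (x - r) Q(x) + P*(r)  with
  -- Q = P* d (quotient r d c) of degree d.
  quotient : Carrier → ℕ → (ℕ → Carrier) → ℕ → Carrier
  quotient r zero c _ = c 1
  quotient r (suc d) c zero = P* (suc d) (tail c) r
  quotient r (suc d) c (suc i) = quotient r d (tail c) i

  division : ∀ r d c x → P* (suc d) c x ≈ (x - r) * P* d (quotient r d c) x + P* (suc d) c r
  division r zero c x =
    solve 5 (λ c₀ c₁ x r o → c₀ :* o :+ c₁ :* (x :* o)
                           := (x :- r) :* (c₁ :* o) :+ (c₀ :* o :+ c₁ :* (r :* o)))
      refl (c 0) (c 1) x r 1#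
  division r (suc d) c x = begin
    P* (suc (suc d)) c x                    ≈⟨ P*-suc (suc d) c x ⟩
    c 0 + x * P* (suc d) (tail c) x         ≈⟨ +-congˡ (*-congˡ (division r d (tail c) x)) ⟩
    c 0 + x * ((x - r) * Q + ρ)
      ≈⟨ solve 5 (λ c₀ x r q p → c₀ :+ x :* ((x :- r) :* q :+ p)
                               := (x :- r) :* (p :+ x :* q) :+ (c₀ :+ r :* p)) refl (c 0) x r Q ρ ⟩
    (x - r) * (ρ + x * Q) + (c 0 + r * ρ)
      ≈⟨ sym (+-cong (*-congˡ (P*-suc d (quotient r (suc d) c) x)) (P*-suc (suc d) c r)) ⟩
    (x - r) * P* (suc d) (quotient r (suc d) c) x + P* (suc (suc d)) c r
      ∎
    where
    Q = P* d (quotient r d (tail c)) x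
    ρ = P* (suc d) (tail c) r

  fromℕ-sub≉0 : ∀ {s t} → s < t → ¬ (fromℕ t - fromℕ s ≈ 0#)
  fromℕ-sub≉0 s<t e = ℕP.<⇒≢ s<t (≡.sym (fromℕ-injective (x∙y⁻¹≈ε⇒x≈y _ _ e)))

  -- Induction on d: dividing out the root s gives a quotient with roots
  -- s+1, s+2, ..., which is zero by induction, so the polynomial vanishes
  -- everywhere; then its constant term is its value at 0 and the
  -- remaining coefficients form a polynomial with roots 1, 2, ...
  vanish : ∀ d c s → (∀ t → s ≤ t → P* d c (fromℕ t) ≈ 0#) → ∀ i → i ≤ d → c i ≈ 0#
  vanish zero c s roots zero _ = trans (sym (*-identityʳ _)) (roots s ℕP.≤-refl)
  vanish (suc d) c s roots = coefficient
    where
    r = fromℕ s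
    q = quotient r d c
    root-r : P* (suc d) c r ≈ 0#
    root-r = roots s ℕP.≤-refl
    quotient-roots : ∀ t → suc s ≤ t → P* d q (fromℕ t) ≈ 0#
    quotient-roots t s<t = no-zero-divisors (fromℕ-sub≉0 s<t) (begin
      (x - r) * P* d q x                     ≈⟨ sym (+-identityʳ _) ⟩
      (x - r) * P* d q x + 0#                ≈⟨ +-congˡ (sym root-r) ⟩
      (x - r) * P* d q x + P* (suc d) c r    ≈⟨ sym (division r d c x) ⟩
      P* (suc d) c x                         ≈⟨ roots t (ℕP.<⇒≤ s<t) ⟩
      0#                                     ∎)
      where x = fromℕ t
    everywhere : ∀ x → P* (suc d) c x ≈ 0#
    everywhere x = begin
      P* (suc d) c x                         ≈⟨ division r d c x ⟩
      (x - r) * P* d q x + P* (suc d) c r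
        ≈⟨ +-cong (*-congˡ (P*-zero d q x (vanish d q (suc s) quotient-roots))) root-r ⟩
      (x - r) * 0# + 0#                      ≈⟨ trans (+-identityʳ _) (zeroʳ _) ⟩
      0#                                     ∎
    constant : c 0 ≈ 0#
    constant = begin
      c 0                                    ≈⟨ sym (+-identityʳ _) ⟩
      c 0 + 0#                               ≈⟨ +-congˡ (sym (zeroˡ _)) ⟩
      c 0 + 0# * P* d (tail c) 0#            ≈⟨ sym (P*-suc d c 0#) ⟩
      P* (suc d) c 0#                        ≈⟨ everywhere 0# ⟩
      0#                                     ∎
    tail-roots : ∀ t → 1 ≤ t → P* d (tail c) (fromℕ t) ≈ 0#
    tail-roots (suc t) _ = no-zero-divisors (fromℕ≉0 {suc t} (λ ())) (begin
      x * P* d (tail c) x                    ≈⟨ sym (+-identityˡ _) ⟩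
      0# + x * P* d (tail c) x               ≈⟨ +-congʳ (sym constant) ⟩
      c 0 + x * P* d (tail c) x              ≈⟨ sym (P*-suc d c x) ⟩
      P* (suc d) c x                         ≈⟨ everywhere x ⟩
      0#                                     ∎)
      where x = fromℕ (suc t)
    coefficient : ∀ i → i ≤ suc d → c i ≈ 0#
    coefficient zero _ = constant
    coefficient (suc i) (s≤s i≤d) = vanish d (tail c) 1 tail-roots i i≤d

  P*-unique : ∀ d p q → (∀ x → ¬ (x ≈ 1#) → P* d p x ≈ P* d q x) →
    ∀ i → i ≤ d → p i ≈ q i
  P*-unique d p q agree i i≤d =
    x∙y⁻¹≈ε⇒x≈y _ _ (vanish d (λ k → p k - q k) 2 difference-roots i i≤d)
    where
    difference-roots : ∀ t → 2 ≤ t → P* d (λ k → p k - q k) (fromℕ t) ≈ 0#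
    difference-roots t 2≤t = begin
      P* d (λ k → p k - q k) x
        ≈⟨ sumTo-cong d (λ k _ → solve 3 (λ a b y → (a :- b) :* y := a :* y :- b :* y) refl _ _ _) ⟩
      sumTo d (λ k → p k * pow x k - q k * pow x k)   ≈⟨ sumTo-- d _ _ ⟩
      P* d p x - P* d q x                             ≈⟨ +-congʳ (agree x x≉1) ⟩
      P* d q x - P* d q x                             ≈⟨ -‿inverseʳ _ ⟩
      0#                                              ∎
      where
      x = fromℕ t
      x≉1 : ¬ (x ≈ 1#)
      x≉1 e = ℕP.<⇒≢ 2≤t (≡.sym (fromℕ-injective {t} {1} (trans e (sym (+-identityʳ 1#)))))

  P≈P*-rev : ∀ d p x → P d p x ≈ P* d (λ j → p (d ∸ j)) x
  P≈P*-rev d p x = trans (sumTo-rev d _) (sumTo-cong d (λ j j≤d →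
    reflexive (≡.cong (λ e → p (d ∸ j) * pow x e) (ℕP.m∸[m∸n]≡n j≤d))))

  P-cong : ∀ d {p q} → (∀ i → i ≤ d → p i ≈ q i) → ∀ x → P d p x ≈ P d q x
  P-cong d p≈q x = sumTo-cong d (λ i i≤d → *-congʳ (p≈q i i≤d))

  P-scale : ∀ d e p x → e * P d p x ≈ P d (λ i → e * p i) x
  P-scale d e p x = trans (sumTo-*ˡ d e _) (sumTo-cong d (λ _ _ → sym (*-assoc _ _ _)))

  P-unique : ∀ d p q → (∀ x → ¬ (x ≈ 1#) → P d p x ≈ P d q x) →
    ∀ i → i ≤ d → p i ≈ q i
  P-unique d p q agree i i≤d =
    ≡.subst (λ k → p k ≈ q k) (ℕP.m∸[m∸n]≡n i≤d) (P*-unique d _ _ agree-rev (d ∸ i) (ℕP.m∸n≤m d i))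
    where
    agree-rev : ∀ x → ¬ (x ≈ 1#) → P* d (λ j → p (d ∸ j)) x ≈ P* d (λ j → q (d ∸ j)) x
    agree-rev x x≉1 = trans (sym (P≈P*-rev d p x)) (trans (agree x x≉1) (P≈P*-rev d q x))

C-factorial : ∀ {n k} → k ≤ n → (n C k) ℕ.* (k ! ℕ.* (n ∸ k) !) ≡ n !
C-factorial {n} {k} k≤n =
  ≡.trans (≡.cong (ℕ._* (k ! ℕ.* (n ∸ k) !)) (nCk≡n!/k![n-k]! k≤n))
          (m/n*n≡m {{k ℕP.!* (n ∸ k) !≢0}} (k![n∸k]!∣n! k≤n))

!≢0 : ∀ n → ¬ (n ! ≡ 0)
!≢0 n = ℕ.≢-nonZero⁻¹ (n !) {{n ℕP.!≢0}}

C≢0 : ∀ {n k} → k ≤ n → ¬ (n C k ≡ 0)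
C≢0 {n} {k} k≤n C≡0 = !≢0 n (≡.trans (≡.sym (C-factorial k≤n))
  (≡.cong (ℕ._* (k ! ℕ.* (n ∸ k) !)) C≡0))

-- Choosing k of m elements and then n - k more of the remaining m - k
-- is the same as choosing n of m and then k of those n:
-- C(m-k, n-k) C(m, k) = C(m, n) C(n, k).
C-subset : ∀ {m n k} → k ≤ n → n ≤ m → ((m ∸ k) C (n ∸ k)) ℕ.* (m C k) ≡ (m C n) ℕ.* (n C k)
C-subset {m} {n} {k} k≤n n≤m =
  ℕP.*-cancelʳ-≡ _ _ X {{X≢0}} (≡.trans left-side (≡.sym right-side))
  where
  open ≡.≡-Reasoning
  open +-*-Solver
  -- both sides times  k! (n-k)! (m-n)!  equal m!
  X = k ! ℕ.* ((n ∸ k) ! ℕ.* (m ∸ n) !)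
  X≢0 : ℕ.NonZero X
  X≢0 = ℕP.m*n≢0 (k !) _ {{k ℕP.!≢0}} {{(n ∸ k) ℕP.!* (m ∸ n) !≢0}}
  A = (m ∸ k) C (n ∸ k)
  B = m C k
  [m-k]-[n-k]≡m-n : (m ∸ k) ∸ (n ∸ k) ≡ m ∸ n
  [m-k]-[n-k]≡m-n = ≡.trans (ℕP.∸-+-assoc m k (n ∸ k)) (≡.cong (m ∸_) (ℕP.m+[n∸m]≡n k≤n))
  left-side : A ℕ.* B ℕ.* X ≡ m !
  left-side = begin
    A ℕ.* B ℕ.* X
      ≡⟨ solve 5 (λ a b f g h → a :* b :* (f :* (g :* h)) := b :* (f :* (a :* (g :* h))))
           ≡.refl A B (k !) ((n ∸ k) !) ((m ∸ n) !) ⟩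
    B ℕ.* (k ! ℕ.* (A ℕ.* ((n ∸ k) ! ℕ.* (m ∸ n) !)))
      ≡⟨ ≡.cong (λ j → B ℕ.* (k ! ℕ.* (A ℕ.* ((n ∸ k) ! ℕ.* j !)))) (≡.sym [m-k]-[n-k]≡m-n) ⟩
    B ℕ.* (k ! ℕ.* (A ℕ.* ((n ∸ k) ! ℕ.* ((m ∸ k) ∸ (n ∸ k)) !)))
      ≡⟨ ≡.cong (λ j → B ℕ.* (k ! ℕ.* j)) (C-factorial (ℕP.∸-monoˡ-≤ k n≤m)) ⟩
    B ℕ.* (k ! ℕ.* (m ∸ k) !)
      ≡⟨ C-factorial (ℕP.≤-trans k≤n n≤m) ⟩
    m ! ∎
  right-side : (m C n) ℕ.* (n C k) ℕ.* X ≡ m !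
  right-side = begin
    (m C n) ℕ.* (n C k) ℕ.* X
      ≡⟨ solve 5 (λ c d f g h → c :* d :* (f :* (g :* h)) := c :* ((d :* (f :* g)) :* h))
           ≡.refl (m C n) (n C k) (k !) ((n ∸ k) !) ((m ∸ n) !) ⟩
    (m C n) ℕ.* (((n C k) ℕ.* (k ! ℕ.* (n ∸ k) !)) ℕ.* (m ∸ n) !)
      ≡⟨ ≡.cong (λ j → (m C n) ℕ.* (j ℕ.* (m ∸ n) !)) (C-factorial k≤n) ⟩
    (m C n) ℕ.* (n ! ℕ.* (m ∸ n) !)
      ≡⟨ C-factorial n≤m ⟩
    m ! ∎

module IntegerBinomials {c ℓ : Level} (F : Field c ℓ) where
  open Defns F
  open Arithmetic F
  open Powers F
  open import Relation.Binary.Reasoning.Setoid setoid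

  falling-neg : ∀ N k → falling (- fromℕ (suc N)) k * fromℕ (N !) ≈ sign k * fromℕ ((N ℕ.+ k) !)
  falling-neg N zero = reflexive (≡.cong (λ j → 1# * fromℕ (j !)) (≡.sym (ℕP.+-identityʳ N)))
  falling-neg N (suc k) = begin
    (falling y k * (y - fromℕ k)) * fromℕ (N !)
      ≈⟨ solve 3 (λ f d n → (f :* d) :* n := (f :* n) :* d) refl _ _ _ ⟩
    (falling y k * fromℕ (N !)) * (y - fromℕ k)
      ≈⟨ *-cong (falling-neg N k) y-k≈ ⟩
    (sign k * fromℕ ((N ℕ.+ k) !)) * - fromℕ (suc (N ℕ.+ k))
      ≈⟨ solve 3 (λ s f q → (s :* f) :* (:- q) := (:- s) :* (q :* f)) refl _ _ _ ⟩
    - sign k * (fromℕ (suc (N ℕ.+ k)) * fromℕ ((N ℕ.+ k) !))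
      ≈⟨ *-congʳ (sym (-1*x≈-x (sign k))) ⟩
    sign (suc k) * (fromℕ (suc (N ℕ.+ k)) * fromℕ ((N ℕ.+ k) !))
      ≈⟨ *-congˡ (sym (fromℕ-* (suc (N ℕ.+ k)) ((N ℕ.+ k) !))) ⟩
    sign (suc k) * fromℕ (suc (N ℕ.+ k) !)
      ≡⟨ ≡.cong (λ j → sign (suc k) * fromℕ (j !)) (≡.sym (ℕP.+-suc N k)) ⟩
    sign (suc k) * fromℕ ((N ℕ.+ suc k) !)
      ∎
    where
    y = - fromℕ (suc N)
    y-k≈ : y - fromℕ k ≈ - fromℕ (suc (N ℕ.+ k))
    y-k≈ = trans (⁻¹-∙-comm _ _) (-‿cong (sym (fromℕ-+ (suc N) k)))

  binom-neg : ∀ N k → binom (- fromℕ (suc N)) k ≈ sign k * fromℕ ((N ℕ.+ k) C k)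
  binom-neg N k = begin
    f * k!⁻¹                              ≈⟨ *-congʳ falling≈ ⟩
    (sign k * (coeff * k!)) * k!⁻¹            ≈⟨ solve 4 (λ s c f i → (s :* (c :* f)) :* i := (s :* c) :* (f :* i))
                                                refl _ _ _ _ ⟩
    (sign k * coeff) * (k! * k!⁻¹)            ≈⟨ *-congˡ (⁻¹-inverse k! (fromℕ≉0 (!≢0 k))) ⟩
    (sign k * coeff) * 1#                     ≈⟨ *-identityʳ _ ⟩
    sign k * coeff                         ∎
    where
    f = falling (- fromℕ (suc N)) k
    coeff = fromℕ ((N ℕ.+ k) C k)
    k! = fromℕ (k !)
    k!⁻¹ = k! ⁻¹
    N! = fromℕ (N !)
    C-factorial′ : ((N ℕ.+ k) C k) ℕ.* (k ! ℕ.* N !) ≡ (N ℕ.+ k) !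
    C-factorial′ = ≡.trans (≡.cong (λ j → ((N ℕ.+ k) C k) ℕ.* (k ! ℕ.* j !)) (≡.sym (ℕP.m+n∸n≡m N k)))
                           (C-factorial (ℕP.m≤n+m k N))
    falling≈ : f ≈ sign k * (coeff * k!)
    falling≈ = *-cancelʳ (fromℕ≉0 (!≢0 N)) (begin
      f * N!                                        ≈⟨ falling-neg N k ⟩
      sign k * fromℕ ((N ℕ.+ k) !)                  ≡⟨ ≡.cong (λ j → sign k * fromℕ j) (≡.sym C-factorial′) ⟩
      sign k * fromℕ (((N ℕ.+ k) C k) ℕ.* (k ! ℕ.* N !))
        ≈⟨ *-congˡ (trans (fromℕ-* ((N ℕ.+ k) C k) _) (*-congˡ (fromℕ-* (k !) (N !)))) ⟩
      sign k * (coeff * (k! * N!))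
        ≈⟨ solve 4 (λ s c a b → s :* (c :* (a :* b)) := (s :* (c :* a)) :* b) refl _ _ _ _ ⟩
      (sign k * (coeff * k!)) * N!                  ∎)

  falling-vanish : ∀ N k → N < k → falling (fromℕ N) k ≈ 0#
  falling-vanish N (suc k) N<k+1 with N ℕP.≟ k
  ... | yes ≡.refl = trans (*-congˡ (-‿inverseʳ _)) (zeroʳ _)
  ... | no N≢k = trans (*-congʳ (falling-vanish N k (ℕP.≤∧≢⇒< (ℕP.≤-pred N<k+1) N≢k))) (zeroˡ _)

module Conditions {c ℓ : Level} (F : Field c ℓ) (m : ℕ) (a : ℕ → Field.Carrier F)
                  (ε : Field.Carrier F) where
  open Defns F
  open Arithmetic F
  open Powers F
  open Sums F
  open Shear F
  open PolynomialIdentity F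
  open IntegerBinomials F
  open import Relation.Binary.Reasoning.Setoid setoid

  b : ℕ → Carrier
  b = sheared m a

  CondS : Set ℓ
  CondS = ∀ n → n ≤ m → sign n * b n ≈ ε * a n

  -- (a)  (1 - x)^m P*(x / (x - 1)) = Σ_n (-1)^n b_n x^n,  by the shear with
  -- u = -x, v = 1, since (1 - x) · x/(x - 1) = -x.
  transformA : ∀ x → ¬ (x ≈ 1#) →
    pow (1# - x) m * P* m a (x * (x - 1#) ⁻¹) ≈ P* m (λ n → sign n * b n) x
  transformA x x≉1 = begin
    pow (1# - x) m * sumTo m (λ k → a k * pow y k)
      ≈⟨ sumTo-*ˡ m _ _ ⟩
    sumTo m (λ k → pow (1# - x) m * (a k * pow y k))
      ≈⟨ sumTo-cong m term ⟩
    sumTo m (λ k → a k * (pow (- x) k * pow (- x + 1#) (m ∸ k)))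
      ≈⟨ shear-expansion m a (- x) 1# ⟩
    sumTo m (λ n → b n * (pow (- x) n * pow 1# (m ∸ n)))
      ≈⟨ sumTo-cong m (λ n _ → monomial n) ⟩
    P* m (λ n → sign n * b n) x
      ∎
    where
    y = x * (x - 1#) ⁻¹
    [1-x]y≈-x : (1# - x) * y ≈ - x
    [1-x]y≈-x = begin
      (1# - x) * (x * (x - 1#) ⁻¹)
        ≈⟨ solve 3 (λ o x w → (o :- x) :* (x :* w) := :- (x :* ((x :- o) :* w))) refl 1# x _ ⟩
      - (x * ((x - 1#) * (x - 1#) ⁻¹))
        ≈⟨ -‿cong (*-congˡ (⁻¹-inverse _ (λ x-1≈0 → x≉1 (x∙y⁻¹≈ε⇒x≈y x 1# x-1≈0)))) ⟩
      - (x * 1#)   ≈⟨ -‿cong (*-identityʳ x) ⟩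
      - x          ∎
    term : ∀ k → k ≤ m →
      pow (1# - x) m * (a k * pow y k) ≈ a k * (pow (- x) k * pow (- x + 1#) (m ∸ k))
    term k k≤m = begin
      pow (1# - x) m * (a k * pow y k)
        ≡⟨ ≡.cong (λ j → pow (1# - x) j * (a k * pow y k)) (≡.sym (ℕP.m∸n+n≡m k≤m)) ⟩
      pow (1# - x) (m ∸ k ℕ.+ k) * (a k * pow y k)
        ≈⟨ *-congʳ (pow-+ _ (m ∸ k) k) ⟩
      (pow (1# - x) (m ∸ k) * pow (1# - x) k) * (a k * pow y k)
        ≈⟨ solve 4 (λ p q α w → (p :* q) :* (α :* w) := α :* ((q :* w) :* p)) refl _ _ _ _ ⟩
      a k * ((pow (1# - x) k * pow y k) * pow (1# - x) (m ∸ k))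
        ≈⟨ *-congˡ (*-cong (trans (sym (pow-* _ _ k)) (pow-cong k [1-x]y≈-x))
                           (pow-cong (m ∸ k) (+-comm _ _))) ⟩
      a k * (pow (- x) k * pow (- x + 1#) (m ∸ k))
        ∎
    monomial : ∀ n → b n * (pow (- x) n * pow 1# (m ∸ n)) ≈ (sign n * b n) * pow x n
    monomial n = begin
      b n * (pow (- x) n * pow 1# (m ∸ n))  ≈⟨ *-congˡ (*-cong (pow-neg x n) (pow-1 (m ∸ n))) ⟩
      b n * ((sign n * pow x n) * 1#)       ≈⟨ *-congˡ (*-identityʳ _) ⟩
      b n * (sign n * pow x n)              ≈⟨ solve 3 (λ β s p → β :* (s :* p) := (s :* β) :* p) refl _ _ _ ⟩
      (sign n * b n) * pow x n              ∎

  A⇔S : CondA m a ε ⇔ CondS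
  A⇔S = mk⇔ A⇒S S⇒A
    where
    A⇒S : CondA m a ε → CondS
    A⇒S condA = P*-unique m _ _ (λ x x≉1 →
      trans (sym (transformA x x≉1)) (trans (condA x x≉1) (P*-scale m ε a x)))
    S⇒A : CondS → CondA m a ε
    S⇒A condS x x≉1 =
      trans (transformA x x≉1) (trans (P*-cong m condS x) (sym (P*-scale m ε a x)))

  -- (b)  P(1 - x) = Σ_n (-1)^(m-n) b_n x^(m-n),  by the shear with u = 1, v = -x.
  transformB : ∀ x → P m a (1# - x) ≈ P m (λ n → sign (m ∸ n) * b n) x
  transformB x = begin
    sumTo m (λ k → a k * pow (1# - x) (m ∸ k))
      ≈⟨ sumTo-cong m (λ k _ → *-congˡ (sym (trans (*-congʳ (pow-1 k)) (*-identityˡ _)))) ⟩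
    sumTo m (λ k → a k * (pow 1# k * pow (1# + - x) (m ∸ k)))
      ≈⟨ shear-expansion m a 1# (- x) ⟩
    sumTo m (λ n → b n * (pow 1# n * pow (- x) (m ∸ n)))
      ≈⟨ sumTo-cong m (λ n _ → monomial n) ⟩
    P m (λ n → sign (m ∸ n) * b n) x
      ∎
    where
    monomial : ∀ n →
      b n * (pow 1# n * pow (- x) (m ∸ n)) ≈ (sign (m ∸ n) * b n) * pow x (m ∸ n)
    monomial n = begin
      b n * (pow 1# n * pow (- x) (m ∸ n))
        ≈⟨ *-congˡ (trans (*-cong (pow-1 n) (pow-neg x (m ∸ n))) (*-identityˡ _)) ⟩
      b n * (sign (m ∸ n) * pow x (m ∸ n))
        ≈⟨ solve 3 (λ β s p → β :* (s :* p) := (s :* β) :* p) refl _ _ _ ⟩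
      (sign (m ∸ n) * b n) * pow x (m ∸ n)
        ∎

  -- The coefficients of (b), compared at x^(m-n), say the same as (S)
  -- after multiplying by  (-1)^m = (-1)^n (-1)^(m-n).
  B-coefficients⇔S :
    (∀ n → n ≤ m → sign (m ∸ n) * b n ≈ ε * (sign m * a n)) ⇔ CondS
  B-coefficients⇔S = mk⇔ to from
    where
    to : (∀ n → n ≤ m → sign (m ∸ n) * b n ≈ ε * (sign m * a n)) → CondS
    to coeffB n n≤m = begin
      sign n * b n                          ≈⟨ sym (sign-cancel m _) ⟩
      sign m * (sign m * (sign n * b n))    ≈⟨ *-congˡ (sym (*-assoc _ _ _)) ⟩
      sign m * ((sign m * sign n) * b n)    ≈⟨ *-congˡ (*-congʳ (sym (sign-∸ n≤m))) ⟩
      sign m * (sign (m ∸ n) * b n)         ≈⟨ *-congˡ (coeffB n n≤m) ⟩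
      sign m * (ε * (sign m * a n))
        ≈⟨ solve 3 (λ s e α → s :* (e :* (s :* α)) := e :* (s :* (s :* α))) refl _ _ _ ⟩
      ε * (sign m * (sign m * a n))         ≈⟨ *-congˡ (sign-cancel m _) ⟩
      ε * a n                               ∎
    from : CondS → ∀ n → n ≤ m → sign (m ∸ n) * b n ≈ ε * (sign m * a n)
    from condS n n≤m = begin
      sign (m ∸ n) * b n                    ≈⟨ *-congʳ (sign-∸ n≤m) ⟩
      (sign m * sign n) * b n               ≈⟨ *-assoc _ _ _ ⟩
      sign m * (sign n * b n)               ≈⟨ *-congˡ (condS n n≤m) ⟩
      sign m * (ε * a n)                    ≈⟨ solve 3 (λ s e α → s :* (e :* α) := e :* (s :* α)) refl _ _ _ ⟩
      ε * (sign m * a n)                    ∎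

  B⇔S : CondB m a ε ⇔ CondS
  B⇔S = mk⇔ (λ condB → Equivalence.to B-coefficients⇔S (P-unique m _ _ (λ x _ →
              trans (sym (transformB x)) (trans (condB x) (scaled x)))))
            (λ condS x → trans (transformB x)
              (trans (P-cong m (Equivalence.from B-coefficients⇔S condS) x) (sym (scaled x))))
    where
    scaled : ∀ x → ε * (sign m * P m a x) ≈ P m (λ n → ε * (sign m * a n)) x
    scaled x = trans (*-congˡ (P-scale m (sign m) a x)) (P-scale m ε _ x)

  -- (c)  For n ≤ m, binom(n-m-1, k) = (-1)^k C(m-n+k, k); reversing the sum
  -- turns  Σ_k binom(n-m-1, k) (-1)^(n-k) a_(n-k)  into  (-1)^n b_n.
  sumC≈ : ∀ n → n ≤ m → sumC m a n ≈ sign n * b n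
  sumC≈ n n≤m = begin
    sumC m a n
      ≈⟨ sumTo-cong n (λ k _ → *-congʳ (trans (reflexive (≡.cong (λ z → binom (fromℤ z) k) n-[m+1]≡))
                                              (binom-neg N k))) ⟩
    sumTo n (λ k → (sign k * fromℕ ((N ℕ.+ k) C k)) * (sign (n ∸ k) * a (n ∸ k)))
      ≈⟨ sumTo-cong n (λ k k≤n → trans
           (solve 4 (λ s γ t α → (s :* γ) :* (t :* α) := (s :* t) :* (γ :* α)) refl _ _ _ _)
           (*-congʳ (sign-split k≤n))) ⟩
    sumTo n (λ k → sign n * (fromℕ ((N ℕ.+ k) C k) * a (n ∸ k)))
      ≈⟨ sym (sumTo-*ˡ n _ _) ⟩
    sign n * sumTo n (λ k → fromℕ ((N ℕ.+ k) C k) * a (n ∸ k))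
      ≈⟨ *-congˡ (sumTo-rev n _) ⟩
    sign n * sumTo n (λ j → fromℕ ((N ℕ.+ (n ∸ j)) C (n ∸ j)) * a (n ∸ (n ∸ j)))
      ≈⟨ *-congˡ (sumTo-cong n (λ j j≤n → reflexive (reindex j j≤n))) ⟩
    sign n * b n
      ∎
    where
    N = m ∸ n
    n-[m+1]≡ : + n ℤ.- + suc m ≡ -[1+ N ]
    n-[m+1]≡ = ≡.trans (ℤP.⊖-< (s≤s n≤m)) (≡.cong (λ z → ℤ.- (+ z)) (ℕP.+-∸-assoc 1 n≤m))
    reindex : ∀ j → j ≤ n →
      fromℕ ((N ℕ.+ (n ∸ j)) C (n ∸ j)) * a (n ∸ (n ∸ j)) ≡ fromℕ ((m ∸ j) C (n ∸ j)) * a j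
    reindex j j≤n = ≡.cong₂ (λ p q → fromℕ (p C (n ∸ j)) * a q)
      (≡.trans (≡.sym (ℕP.+-∸-assoc N j≤n)) (≡.cong (_∸ j) (ℕP.m∸n+n≡m n≤m)))
      (ℕP.m∸[m∸n]≡n j≤n)

  C⇔S : CondC m a ε ⇔ CondS
  C⇔S = mk⇔ (λ condC n n≤m → trans (sym (sumC≈ n n≤m)) (condC n n≤m))
            (λ condS n n≤m → trans (sumC≈ n n≤m) (condS n n≤m))

  -- (d)  Beyond n = m the identity holds automatically: each term has either
  -- a_(n-k) = 0 (when n - k > m) or a vanishing factor
  -- binom(n-m-1, k) = 0 (when k > n - m - 1 ≥ 0).
  extend-≤ : ∀ n → n ≤ m → extend m a n ≡ a n
  extend-≤ n n≤m with n ℕ.≤? m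
  ... | yes _ = ≡.refl
  ... | no n≰m = ⊥-elim (n≰m n≤m)

  extend-> : ∀ n → m < n → extend m a n ≡ 0#
  extend-> n m<n with n ℕ.≤? m
  ... | yes n≤m = ⊥-elim (ℕP.<⇒≱ m<n n≤m)
  ... | no _ = ≡.refl

  sumC-extend-≤ : ∀ n → n ≤ m → sumC m (extend m a) n ≈ sumC m a n
  sumC-extend-≤ n n≤m = sumTo-cong n (λ k _ →
    *-congˡ (*-congˡ (reflexive (extend-≤ (n ∸ k) (ℕP.≤-trans (ℕP.m∸n≤m n k) n≤m)))))

  sumC-extend-> : ∀ n → m < n → sumC m (extend m a) n ≈ 0#
  sumC-extend-> n m<n = sumTo-0 n _ term
    where
    N = n ∸ suc m
    term : ∀ k → k ≤ n →
      binom (fromℤ (+ n ℤ.- + suc m)) k * (sign (n ∸ k) * extend m a (n ∸ k)) ≈ 0#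
    term k k≤n with k ℕ.≤? N
    ... | yes k≤N = trans (*-congˡ (trans (*-congˡ (reflexive (extend-> (n ∸ k) m<n-k))) (zeroʳ _)))
                          (zeroʳ _)
      where
      m<n-k : m < n ∸ k
      m<n-k = ℕP.≤-trans (ℕP.≤-reflexive (≡.sym (ℕP.m∸[m∸n]≡n m<n))) (ℕP.∸-monoʳ-≤ n k≤N)
    ... | no k≰N = trans (*-congʳ binom≈0) (zeroˡ _)
      where
      binom≈0 : binom (fromℤ (+ n ℤ.- + suc m)) k ≈ 0#
      binom≈0 = trans (reflexive (≡.cong (λ z → binom (fromℤ z) k) (ℤP.⊖-≥ m<n)))
                      (trans (*-congʳ (falling-vanish N k (ℕP.≰⇒> k≰N))) (zeroˡ _))

  C⇔D : CondC m a ε ⇔ CondD m a ε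
  C⇔D = mk⇔ C⇒D D⇒C
    where
    C⇒D : CondC m a ε → CondD m a ε
    C⇒D condC n = by-cases (n ℕ.≤? m)
      where
      by-cases : Dec (n ≤ m) → sumC m (extend m a) n ≈ ε * extend m a n
      by-cases (yes n≤m) = begin
        sumC m (extend m a) n   ≈⟨ sumC-extend-≤ n n≤m ⟩
        sumC m a n              ≈⟨ condC n n≤m ⟩
        ε * a n                 ≡⟨ ≡.cong (ε *_) (≡.sym (extend-≤ n n≤m)) ⟩
        ε * extend m a n        ∎
      by-cases (no n≰m) = begin
        sumC m (extend m a) n   ≈⟨ sumC-extend-> n (ℕP.≰⇒> n≰m) ⟩
        0#                      ≈⟨ sym (zeroʳ ε) ⟩
        ε * 0#                  ≡⟨ ≡.cong (ε *_) (≡.sym (extend-> n (ℕP.≰⇒> n≰m))) ⟩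
        ε * extend m a n        ∎
    D⇒C : CondD m a ε → CondC m a ε
    D⇒C condD n n≤m = begin
      sumC m a n              ≈⟨ sym (sumC-extend-≤ n n≤m) ⟩
      sumC m (extend m a) n   ≈⟨ condD n ⟩
      ε * extend m a n        ≡⟨ ≡.cong (ε *_) (extend-≤ n n≤m) ⟩
      ε * a n                 ∎

  -- (e)  b_n = C(m, n) Σ_k C(n, k) a_k / C(m, k), by the subset identity,
  -- and C(m, n) is invertible for n ≤ m.
  -- The left-hand side of (e).
  E-sum : ℕ → Carrier
  E-sum n = sumTo n (λ k → fromℕ (n C k) * (a k * (fromℕ (m C k) ⁻¹)))

  mCk≉0 : ∀ {k} → k ≤ m → ¬ (fromℕ (m C k) ≈ 0#)
  mCk≉0 k≤m = fromℕ≉0 (C≢0 k≤m)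

  b≈E-sum : ∀ n → n ≤ m → b n ≈ fromℕ (m C n) * E-sum n
  b≈E-sum n n≤m = trans (sumTo-cong n term) (sym (sumTo-*ˡ n _ _))
    where
    term : ∀ k → k ≤ n →
      fromℕ ((m ∸ k) C (n ∸ k)) * a k ≈ fromℕ (m C n) * (fromℕ (n C k) * (a k * fromℕ (m C k) ⁻¹))
    term k k≤n = begin
      γ * a k
        ≈⟨ *-congʳ (sym (⁻¹-cancelˡ γ (mCk≉0 (ℕP.≤-trans k≤n n≤m)))) ⟩
      (((μ ⁻¹) * (μ * γ)) * a k)
        ≈⟨ solve 4 (λ i u g α → ((i :* (u :* g)) :* α) := (g :* u) :* (α :* i)) refl _ _ _ _ ⟩
      (γ * μ) * (a k * μ ⁻¹)
        ≈⟨ *-congʳ (sym (fromℕ-* ((m ∸ k) C (n ∸ k)) (m C k))) ⟩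
      fromℕ (((m ∸ k) C (n ∸ k)) ℕ.* (m C k)) * (a k * μ ⁻¹)
        ≡⟨ ≡.cong (λ j → fromℕ j * (a k * μ ⁻¹)) (C-subset k≤n n≤m) ⟩
      fromℕ ((m C n) ℕ.* (n C k)) * (a k * μ ⁻¹)
        ≈⟨ *-congʳ (fromℕ-* (m C n) (n C k)) ⟩
      (fromℕ (m C n) * fromℕ (n C k)) * (a k * μ ⁻¹)
        ≈⟨ *-assoc _ _ _ ⟩
      fromℕ (m C n) * (fromℕ (n C k) * (a k * μ ⁻¹))
        ∎
      where
      γ = fromℕ ((m ∸ k) C (n ∸ k))
      μ = fromℕ (m C k)

  -- (e) is (S) multiplied by  (-1)^n / C(m, n).
  E⇔S : CondE m a ε ⇔ CondS
  E⇔S = mk⇔ E⇒S S⇒E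
    where
    E⇒S : CondE m a ε → CondS
    E⇒S condE n n≤m = begin
      sign n * b n
        ≈⟨ *-congˡ (b≈E-sum n n≤m) ⟩
      sign n * (μ * E-sum n)
        ≈⟨ *-congˡ (*-congˡ (condE n n≤m)) ⟩
      sign n * (μ * (ε * (sign n * (a n * μ ⁻¹))))
        ≈⟨ solve 5 (λ s u e α i → s :* (u :* (e :* (s :* (α :* i))))
                                := (e :* (s :* (s :* α))) :* (u :* i)) refl _ _ _ _ _ ⟩
      (ε * (sign n * (sign n * a n))) * (μ * μ ⁻¹)
        ≈⟨ *-cong (*-congˡ (sign-cancel n _)) (⁻¹-inverse μ (mCk≉0 n≤m)) ⟩
      (ε * a n) * 1#
        ≈⟨ *-identityʳ _ ⟩
      ε * a n
        ∎
      where μ = fromℕ (m C n)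
    S⇒E : CondS → CondE m a ε
    S⇒E condS n n≤m = begin
      E-sum n                             ≈⟨ sym (⁻¹-cancelˡ _ (mCk≉0 n≤m)) ⟩
      μ ⁻¹ * (μ * E-sum n)                ≈⟨ *-congˡ (sym (b≈E-sum n n≤m)) ⟩
      μ ⁻¹ * b n                          ≈⟨ *-congˡ (sym (sign-cancel n _)) ⟩
      μ ⁻¹ * (sign n * (sign n * b n))    ≈⟨ *-congˡ (*-congˡ (condS n n≤m)) ⟩
      μ ⁻¹ * (sign n * (ε * a n))
        ≈⟨ solve 4 (λ i s e α → i :* (s :* (e :* α)) := e :* (s :* (α :* i))) refl _ _ _ _ ⟩
      ε * (sign n * (a n * μ ⁻¹))         ∎
      where μ = fromℕ (m C n)

theorem2p5 : {c ℓ : Level} (F : Field c ℓ) → let open Defns F in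
    (m : ℕ) → 1 ≤ m → (a : ℕ → Carrier) → (ε : Carrier) → (ε ≈ 1# ⊎ ε ≈ - 1#) →
      (CondA m a ε ⇔ CondB m a ε) × (CondB m a ε ⇔ CondC m a ε)
        × (CondC m a ε ⇔ CondD m a ε) × (CondD m a ε ⇔ CondE m a ε)
theorem2p5 F m _ a ε _ =
    ⇔-sym B⇔S ⇔-∘ A⇔S
  , ⇔-sym C⇔S ⇔-∘ B⇔S
  , C⇔D
  , ⇔-sym E⇔S ⇔-∘ (C⇔S ⇔-∘ ⇔-sym C⇔D)
  where open Conditions F m a ε
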